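{- Let $L_1$ and $L_2$ be disjoint finite lattices, let $a<b$ in $L_1$ with $b$ not covering $a$, and put $L=L_1]_a^bL_2$. Then: (a) If $a\neq 0$ and $a\notin V(G_{\{0\}}(L_1))$, then $G_{\{0\}}(L)=G_{\{0\}}(L_1)$. (b) If $a\in V(G_{\{0\}}(L_1))$, then $G_{\{0\}}(L)=G_{\{0\}}(L_1)\cup\big(G_a+N(L_2)\big)$, where $G_a=\{x\in L_1 : a,x \text{ are adjacent in } G_{\{0\}}(L_1)\}$ (regarded as a graph on this vertex set with no edges). (c) If $a=0$, then $G_{\{0\}}(L)=G_{\{0\}}(L_1)\cup\Big(N\big(L_1^*\setminus[b)\big)+N(L_2)\Big)$, where $[b)=\{x\in L_1 : x\ge b\}$ and $L_1^*=L_1\setminus\{0\}$.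
   Context: Adjunct operation: for disjoint finite lattices $L_1,L_2$ and $a<b$ in $L_1$ with $b$ not covering $a$, $L=L_1]_a^bL_2$ is the set $L_1\cup L_2$ ordered by: $x\le y$ iff ($x,y\in L_1$ and $x\le y$ in $L_1$) or ($x,y\in L_2$ and $x\le y$ in $L_2$) or ($x\in L_1$, $y\in L_2$, $x\le a$ in $L_1$) or ($x\in L_2$, $y\in L_1$, $b\le y$ in $L_1$); this is a lattice. The zero-divisor graph $G_{\{0\}}(L)$ of a lattice $L$ with least element $0$ has vertex set $V(G_{\{0\}}(L))=\{x\in L\setminus\{0\} : x\wedge y=0 \text{ for some } y\in L\setminus\{0\}\}$, distinct vertices $x,y$ adjacent iff $x\wedge y=0$. For graphs $G_1,G_2$: the union $G_1\cup G_2$ has vertex set $V(G_1)\cup V(G_2)$ and edge set $E(G_1)\cup E(G_2)$; the join $G_1+G_2$ has vertex set $V(G_1)\cup V(G_2)$ and edges $E(G_1)\cup E(G_2)\cup\{\{x_1,x_2\}: x_1\in V(G_1),x_2\in V(G_2)\}$. $N(S)$ denotes the null graph (no edges) on the set $S$. -}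

module Defs where

open import Level using (0ℓ)
open import Data.Product using (Σ; _×_; _,_)
open import Data.Sum using (_⊎_; inj₁; inj₂)
open import Data.Empty using (⊥)
open import Data.Unit using (⊤)
open import Data.List using (List)
open import Data.List.Membership.Propositional using (_∈_)
open import Relation.Nullary using (¬_)
open import Relation.Binary.Core using (Rel)
open import Relation.Binary.PropositionalEquality using (_≡_)
open import Relation.Binary.Lattice.Structures using (IsBoundedLattice)
open import Function.Bundles using (_⇔_)

-- Finite lattices (equality is propositional equality; a finite
-- (nonempty) lattice is bounded, so it carries 0 = ⊥ᴸ and 1 = ⊤ᴸ).

record FiniteLattice : Set₁ where
  field
    Carrier   : Set
    _≤_       : Rel Carrier 0ℓ
    _∨_       : Carrier → Carrier → Carrier
    _∧_       : Carrier → Carrier → Carrier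
    ⊤ᴸ        : Carrier
    ⊥ᴸ        : Carrier
    isBoundedLattice : IsBoundedLattice _≡_ _≤_ _∨_ _∧_ ⊤ᴸ ⊥ᴸ
    elements  : List Carrier
    complete  : ∀ x → x ∈ elements

  _<_ : Rel Carrier 0ℓ
  x < y = (x ≤ y) × ¬ (x ≡ y)

  _⋖_ : Rel Carrier 0ℓ
  x ⋖ y = (x < y) × (∀ z → x ≤ z → z ≤ y → (z ≡ x) ⊎ (z ≡ y))

record Graph (V : Set) : Set₁ where
  field
    Vert : V → Set
    Edge : V → V → Set
open Graph public

_≅ᴳ_ : {V : Set} → Graph V → Graph V → Set
G ≅ᴳ H = (∀ x → Vert G x ⇔ Vert H x) × (∀ x y → Edge G x y ⇔ Edge H x y)

_∪ᴳ_ : {V : Set} → Graph V → Graph V → Graph V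
Vert (G ∪ᴳ H) x = Vert G x ⊎ Vert H x
Edge (G ∪ᴳ H) x y = Edge G x y ⊎ Edge H x y

_+ᴳ_ : {V : Set} → Graph V → Graph V → Graph V
Vert (G +ᴳ H) x = Vert G x ⊎ Vert H x
Edge (G +ᴳ H) x y =
  Edge G x y ⊎ Edge H x y ⊎ (Vert G x × Vert H y) ⊎ (Vert H x × Vert G y)

N : {V : Set} → (V → Set) → Graph V
Vert (N S) x = S x
Edge (N S) x y = ⊥

embed₁ : {A B : Set} → Graph A → Graph (A ⊎ B)
Vert (embed₁ G) (inj₁ x) = Vert G x
Vert (embed₁ G) (inj₂ _) = ⊥
Edge (embed₁ G) (inj₁ x) (inj₁ y) = Edge G x y
Edge (embed₁ G) _ _ = ⊥

module _ (L : FiniteLattice) where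
  open FiniteLattice L

  ZDVert : Carrier → Set
  ZDVert x = ¬ (x ≡ ⊥ᴸ) × Σ Carrier (λ y → ¬ (y ≡ ⊥ᴸ) × ((x ∧ y) ≡ ⊥ᴸ))

  ZDG : Graph Carrier
  Vert ZDG x = ZDVert x
  Edge ZDG x y = ZDVert x × ZDVert y × ¬ (x ≡ y) × ((x ∧ y) ≡ ⊥ᴸ)

-- The adjunct L₁ ]_a^b L₂ : carrier L₁ ⊎ L₂ (disjoint by construction)

module _ (L₁ L₂ : FiniteLattice) (a b : FiniteLattice.Carrier L₁) where
  private
    module L₁ = FiniteLattice L₁
    module L₂ = FiniteLattice L₂

  AdjCarrier : Set
  AdjCarrier = L₁.Carrier ⊎ L₂.Carrier

  _≤ᴬ_ : Rel AdjCarrier 0ℓ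
  inj₁ x ≤ᴬ inj₁ y = x L₁.≤ y
  inj₂ x ≤ᴬ inj₂ y = x L₂.≤ y
  inj₁ x ≤ᴬ inj₂ y = x L₁.≤ a
  inj₂ x ≤ᴬ inj₁ y = b L₁.≤ y

  0ᴬ : AdjCarrier
  0ᴬ = inj₁ L₁.⊥ᴸ

  -- "x ∧ y = 0" in the adjunct: 0 is the greatest lower bound of x, y
  -- w.r.t. the adjunct order
  MeetZeroᴬ : AdjCarrier → AdjCarrier → Set
  MeetZeroᴬ x y = (0ᴬ ≤ᴬ x) × (0ᴬ ≤ᴬ y) × (∀ z → z ≤ᴬ x → z ≤ᴬ y → z ≤ᴬ 0ᴬ)

  AdjZDVert : AdjCarrier → Set
  AdjZDVert x = ¬ (x ≡ 0ᴬ) × Σ AdjCarrier (λ y → ¬ (y ≡ 0ᴬ) × MeetZeroᴬ x y)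

  AdjZDG : Graph AdjCarrier
  Vert AdjZDG x = AdjZDVert x
  Edge AdjZDG x y = AdjZDVert x × AdjZDVert y × ¬ (x ≡ y) × MeetZeroᴬ x y

  Gₐ : Graph AdjCarrier
  Gₐ = N (λ { (inj₁ x) → Edge (ZDG L₁) a x ; (inj₂ _) → ⊥ })

  NL₂ : Graph AdjCarrier
  NL₂ = N (λ { (inj₁ _) → ⊥ ; (inj₂ _) → ⊤ })

  NL₁*∖↑b : Graph AdjCarrier
  NL₁*∖↑b = N (λ { (inj₁ x) → ¬ (x ≡ L₁.⊥ᴸ) × ¬ (b L₁.≤ x) ; (inj₂ _) → ⊥ })

-- In L = L₁ ]_a^b L₂ the common lower bounds of x ∈ L₁ and y ∈ L₂ are those of
-- x ∧ a, together with the elements of L₂ below y when b ≤ x; two elements of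
-- L₂ share the bound b ≠ 0.  Hence meets inside L₁ are unchanged, no two
-- elements of L₂ are adjacent, and x ∈ L₁ is adjacent to every (equivalently
-- some) element of L₂ exactly when x ≠ 0, x ∧ a = 0 and b ≰ x.  The three
-- cases only differ in what this condition on x amounts to: it is never met
-- when a ≠ 0 is no zero divisor, it says x is a neighbour of a when a is a
-- zero divisor, and it says x ∉ {0} ∪ [b) when a = 0.  In the last case it
-- is satisfied by some x because b does not cover 0.

module Submission where

open import Defs
open import Level using (0ℓ)
open import Data.Product using (_×_; _,_; ∃; proj₁; proj₂)
open import Data.Sum using (_⊎_; inj₁; inj₂; [_,_]; map₂)
open import Data.Empty using (⊥; ⊥-elim)
open import Data.Unit using (tt)
import Data.Fin.Properties as Fin
open import Data.List using (lookup)
open import Data.List.Relation.Unary.Any as Any using (index; any?; satisfied)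
open import Data.List.Relation.Unary.Any.Properties using (lookup-index)
open import Relation.Nullary using (¬_; yes; no)
open import Relation.Nullary.Decidable using (map′; ¬?; _×-dec_)
open import Relation.Binary.Definitions using (Decidable; DecidableEquality)
open import Relation.Binary.PropositionalEquality
  using (_≡_; _≢_; refl; sym; trans; cong; subst)
open import Relation.Binary.Lattice.Bundles using (MeetSemilattice)
open import Relation.Binary.Lattice.Structures using (IsBoundedLattice)
import Relation.Binary.Lattice.Properties.MeetSemilattice as MeetSemilatticeProperties
open import Function.Bundles using (_⇔_; mk⇔; module Equivalence)
open Equivalence using (to; from)
import Function.Properties.Equivalence as ⇔
open import Function.Base using (id; _∘_)

≅ᴳ-trans : {V : Set} {G H K : Graph V} → G ≅ᴳ H → H ≅ᴳ K → G ≅ᴳ K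
≅ᴳ-trans (vert₁ , edge₁) (vert₂ , edge₂) =
  (λ x → ⇔.trans (vert₁ x) (vert₂ x)) , (λ x y → ⇔.trans (edge₁ x y) (edge₂ x y))

module FiniteLatticeProperties (L : FiniteLattice) where
  open FiniteLattice L
  open IsBoundedLattice isBoundedLattice public
    using (antisym; minimum; x∧y≤x; x∧y≤y; ∧-greatest)
    renaming (refl to ≤-refl; trans to ≤-trans)

  meetSemilattice : MeetSemilattice 0ℓ 0ℓ 0ℓ
  meetSemilattice = record
    { isMeetSemilattice = IsBoundedLattice.isMeetSemilattice isBoundedLattice }

  open MeetSemilatticeProperties meetSemilattice public
    using (∧-comm)

  ≤⊥⇒≡⊥ : ∀ {x} → x ≤ ⊥ᴸ → x ≡ ⊥ᴸ
  ≤⊥⇒≡⊥ x≤⊥ = antisym x≤⊥ (minimum _)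

  ∧≡⊥-comm : ∀ {x y} → x ∧ y ≡ ⊥ᴸ → y ∧ x ≡ ⊥ᴸ
  ∧≡⊥-comm {x} {y} = trans (∧-comm y x)

  ≤∧≡⊥⇒≡⊥ : ∀ {x y} → x ≤ y → x ∧ y ≡ ⊥ᴸ → x ≡ ⊥ᴸ
  ≤∧≡⊥⇒≡⊥ {x} {y} x≤y x∧y≡⊥ =
    ≤⊥⇒≡⊥ (subst (x ≤_) x∧y≡⊥ (∧-greatest ≤-refl x≤y))

  -- Positions in the enumeration `elements` identify elements.
  _≟_ : DecidableEquality Carrier
  x ≟ y = map′ position-injective (cong (λ z → index (complete z)))
                 (index (complete x) Fin.≟ index (complete y))
    where
    position-injective : index (complete x) ≡ index (complete y) → x ≡ y
    position-injective same = trans (lookup-index (complete x))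
      (trans (cong (lookup elements) same) (sym (lookup-index (complete y))))

  _≤?_ : Decidable _≤_
  _≤?_ = MeetSemilatticeProperties.≈-dec⇒≤-dec meetSemilattice _≟_

  ¬⋖⇒∃-between : ∀ {x y} → x < y → ¬ (x ⋖ y) → ∃ λ z → x < z × z < y
  ¬⋖⇒∃-between {x} {y} x<y x⋪y
    with any? (λ z → ((x ≤? z) ×-dec ¬? (x ≟ z)) ×-dec ((z ≤? y) ×-dec ¬? (z ≟ y))) elements
  ... | yes found = satisfied found
  ... | no none = ⊥-elim (x⋪y (x<y , nothing-between))
    where
    nothing-between : ∀ z → x ≤ z → z ≤ y → z ≡ x ⊎ z ≡ y
    nothing-between z x≤z z≤y with z ≟ x | z ≟ y
    ... | yes z≡x | _ = inj₁ z≡x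
    ... | no _ | yes z≡y = inj₂ z≡y
    ... | no z≢x | no z≢y = ⊥-elim (none (Any.map
            (λ { refl → (x≤z , λ x≡z → z≢x (sym x≡z)) , (z≤y , z≢y) }) (complete z)))

  ∧≡⊥⇒≢ : ∀ {x y} → x ≢ ⊥ᴸ → x ∧ y ≡ ⊥ᴸ → x ≢ y
  ∧≡⊥⇒≢ x≢⊥ x∧x≡⊥ refl = x≢⊥ (≤∧≡⊥⇒≡⊥ ≤-refl x∧x≡⊥)

  zdEdge : ∀ {x y} → x ≢ ⊥ᴸ → y ≢ ⊥ᴸ → x ∧ y ≡ ⊥ᴸ → Edge (ZDG L) x y
  zdEdge x≢⊥ y≢⊥ x∧y≡⊥ =
    (x≢⊥ , _ , y≢⊥ , x∧y≡⊥) , (y≢⊥ , _ , x≢⊥ , ∧≡⊥-comm x∧y≡⊥) , ∧≡⊥⇒≢ x≢⊥ x∧y≡⊥ , x∧y≡⊥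

module Adjunct (L₁ L₂ : FiniteLattice) (a b : FiniteLattice.Carrier L₁)
               (a<b : FiniteLattice._<_ L₁ a b) where
  open FiniteLattice L₁
  open FiniteLatticeProperties L₁
  module L₂ where
    open FiniteLattice L₂ public
    open FiniteLatticeProperties L₂ public

  L : Set
  L = AdjCarrier L₁ L₂ a b

  MeetZero : L → L → Set
  MeetZero = MeetZeroᴬ L₁ L₂ a b

  b≢⊥ : b ≢ ⊥ᴸ
  b≢⊥ b≡⊥ = proj₂ a<b (trans (≤⊥⇒≡⊥ (subst (a ≤_) b≡⊥ (proj₁ a<b))) (sym b≡⊥))

  inj₁-≢0ᴬ : ∀ {x} → x ≢ ⊥ᴸ → inj₁ x ≢ 0ᴬ L₁ L₂ a b
  inj₁-≢0ᴬ x≢⊥ refl = x≢⊥ refl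

  inj₁-≢⊥ : ∀ {x} → inj₁ x ≢ 0ᴬ L₁ L₂ a b → x ≢ ⊥ᴸ
  inj₁-≢⊥ x≢0ᴬ x≡⊥ = x≢0ᴬ (cong inj₁ x≡⊥)

  MeetsL₂InZero : Carrier → Set
  MeetsL₂InZero x = x ∧ a ≡ ⊥ᴸ × ¬ (b ≤ x)

  AdjacentToL₂ : Carrier → Set
  AdjacentToL₂ x = x ≢ ⊥ᴸ × MeetsL₂InZero x

  meetZero-sym : ∀ {x y} → MeetZero x y → MeetZero y x
  meetZero-sym (0≤x , 0≤y , glb) = 0≤y , 0≤x , λ z z≤y z≤x → glb z z≤x z≤y

  meetZero₁₁ : ∀ {x y} → MeetZero (inj₁ x) (inj₁ y) ⇔ x ∧ y ≡ ⊥ᴸ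
  meetZero₁₁ {x} {y} = mk⇔
    (λ (_ , _ , glb) → ≤⊥⇒≡⊥ (glb (inj₁ (x ∧ y)) (x∧y≤x x y) (x∧y≤y x y)))
    (λ x∧y≡⊥ → minimum x , minimum y , λ
      { (inj₁ z) z≤x z≤y → subst (z ≤_) x∧y≡⊥ (∧-greatest z≤x z≤y)
      ; (inj₂ _) b≤x b≤y → ⊥-elim (b≢⊥ (≤⊥⇒≡⊥ (subst (b ≤_) x∧y≡⊥ (∧-greatest b≤x b≤y)))) })

  meetZero₁₂ : ∀ {x y} → MeetZero (inj₁ x) (inj₂ y) ⇔ MeetsL₂InZero x
  meetZero₁₂ {x} {y} = mk⇔
    (λ (_ , _ , glb) → ≤⊥⇒≡⊥ (glb (inj₁ (x ∧ a)) (x∧y≤x x a) (x∧y≤y x a)) ,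
                       λ b≤x → b≢⊥ (≤⊥⇒≡⊥ (glb (inj₂ y) b≤x L₂.≤-refl)))
    (λ (x∧a≡⊥ , b≰x) → minimum x , minimum a , λ
      { (inj₁ z) z≤x z≤a → subst (z ≤_) x∧a≡⊥ (∧-greatest z≤x z≤a)
      ; (inj₂ _) b≤x _ → ⊥-elim (b≰x b≤x) })

  ¬meetZero₂₂ : ∀ {x y} → ¬ MeetZero (inj₂ x) (inj₂ y)
  ¬meetZero₂₂ {x} {y} (_ , _ , glb) =
    b≢⊥ (≤⊥⇒≡⊥ (glb (inj₂ L₂.⊥ᴸ) (L₂.minimum x) (L₂.minimum y)))

  vert₁ : ∀ {x} → AdjZDVert L₁ L₂ a b (inj₁ x) ⇔ (ZDVert L₁ x ⊎ AdjacentToL₂ x)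
  vert₁ = mk⇔
    (λ { (x≢0ᴬ , inj₁ y , y≢0ᴬ , x∧y≡0) →
           inj₁ (inj₁-≢⊥ x≢0ᴬ , y , inj₁-≢⊥ y≢0ᴬ , to meetZero₁₁ x∧y≡0)
       ; (x≢0ᴬ , inj₂ _ , _ , x∧y≡0) → inj₂ (inj₁-≢⊥ x≢0ᴬ , to meetZero₁₂ x∧y≡0) })
    (λ { (inj₁ (x≢⊥ , y , y≢⊥ , x∧y≡⊥)) →
           inj₁-≢0ᴬ x≢⊥ , inj₁ y , inj₁-≢0ᴬ y≢⊥ , from meetZero₁₁ x∧y≡⊥
       ; (inj₂ (x≢⊥ , meets)) → inj₁-≢0ᴬ x≢⊥ , inj₂ L₂.⊤ᴸ , (λ ()) , from meetZero₁₂ meets })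

  vert₂ : ∀ {y} → AdjZDVert L₁ L₂ a b (inj₂ y) ⇔ ∃ AdjacentToL₂
  vert₂ = mk⇔
    (λ { (_ , inj₁ x , x≢0ᴬ , y∧x≡0) → x , inj₁-≢⊥ x≢0ᴬ , to meetZero₁₂ (meetZero-sym y∧x≡0)
       ; (_ , inj₂ _ , _ , y∧y′≡0) → ⊥-elim (¬meetZero₂₂ y∧y′≡0) })
    (λ (x , x≢⊥ , meets) → (λ ()) , inj₁ x , inj₁-≢0ᴬ x≢⊥ , meetZero-sym (from meetZero₁₂ meets))

  AdjZDGModel : Graph L
  Vert AdjZDGModel (inj₁ x) = ZDVert L₁ x ⊎ AdjacentToL₂ x
  Vert AdjZDGModel (inj₂ _) = ∃ AdjacentToL₂
  Edge AdjZDGModel (inj₁ x) (inj₁ y) = Edge (ZDG L₁) x y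
  Edge AdjZDGModel (inj₁ x) (inj₂ _) = AdjacentToL₂ x
  Edge AdjZDGModel (inj₂ _) (inj₁ y) = AdjacentToL₂ y
  Edge AdjZDGModel (inj₂ _) (inj₂ _) = ⊥

  AdjZDG≅model : AdjZDG L₁ L₂ a b ≅ᴳ AdjZDGModel
  AdjZDG≅model = vert , edge
    where
    vert : ∀ x → Vert (AdjZDG L₁ L₂ a b) x ⇔ Vert AdjZDGModel x
    vert (inj₁ _) = vert₁
    vert (inj₂ _) = vert₂

    nonzero : ∀ {x} → AdjZDVert L₁ L₂ a b (inj₁ x) → x ≢ ⊥ᴸ
    nonzero (x≢0ᴬ , _) = inj₁-≢⊥ x≢0ᴬ

    edge : ∀ x y → Edge (AdjZDG L₁ L₂ a b) x y ⇔ Edge AdjZDGModel x y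
    edge (inj₁ x) (inj₁ y) = mk⇔
      (λ (vx , vy , _ , x∧y≡0) → zdEdge (nonzero vx) (nonzero vy) (to meetZero₁₁ x∧y≡0))
      (λ (zx , zy , x≢y , x∧y≡⊥) →
        from vert₁ (inj₁ zx) , from vert₁ (inj₁ zy) , (λ { refl → x≢y refl }) , from meetZero₁₁ x∧y≡⊥)
    edge (inj₁ x) (inj₂ y) = mk⇔
      (λ (vx , _ , _ , x∧y≡0) → nonzero vx , to meetZero₁₂ x∧y≡0)
      (λ adj → from vert₁ (inj₂ adj) , from vert₂ (x , adj) , (λ ()) , from meetZero₁₂ (proj₂ adj))
    edge (inj₂ y) (inj₁ x) = mk⇔
      (λ (_ , vx , _ , y∧x≡0) → nonzero vx , to meetZero₁₂ (meetZero-sym y∧x≡0))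
      (λ adj → from vert₂ (x , adj) , from vert₁ (inj₂ adj) , (λ ()) ,
               meetZero-sym (from meetZero₁₂ (proj₂ adj)))
    edge (inj₂ _) (inj₂ _) = mk⇔ (λ (_ , _ , _ , y∧y′≡0) → ¬meetZero₂₂ y∧y′≡0) λ ()

  model≅ZDG : (∀ x → ¬ AdjacentToL₂ x) → AdjZDGModel ≅ᴳ embed₁ (ZDG L₁)
  model≅ZDG nothing-adjacent = vert , edge
    where
    vert : ∀ x → Vert AdjZDGModel x ⇔ Vert (embed₁ (ZDG L₁)) x
    vert (inj₁ x) = mk⇔ [ id , ⊥-elim ∘ nothing-adjacent x ] inj₁
    vert (inj₂ _) = mk⇔ (λ (x , adj) → nothing-adjacent x adj) λ ()

    edge : ∀ x y → Edge AdjZDGModel x y ⇔ Edge (embed₁ (ZDG L₁)) x y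
    edge (inj₁ _) (inj₁ _) = ⇔.refl
    edge (inj₁ x) (inj₂ _) = mk⇔ (nothing-adjacent x) λ ()
    edge (inj₂ _) (inj₁ y) = mk⇔ (nothing-adjacent y) λ ()
    edge (inj₂ _) (inj₂ _) = ⇔.refl

  model≅ZDG∪join : (S : L → Set) → (∀ x → S (inj₁ x) ⇔ AdjacentToL₂ x) → (∀ y → ¬ S (inj₂ y)) →
                   ∃ AdjacentToL₂ →
                   AdjZDGModel ≅ᴳ (embed₁ (ZDG L₁) ∪ᴳ (N S +ᴳ NL₂ L₁ L₂ a b))
  model≅ZDG∪join S S⇔adjacent ¬S₂ some-adjacent = vert , edge
    where
    vert : ∀ x → Vert AdjZDGModel x ⇔ Vert (embed₁ (ZDG L₁) ∪ᴳ (N S +ᴳ NL₂ L₁ L₂ a b)) x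
    vert (inj₁ x) = mk⇔ (map₂ (inj₁ ∘ from (S⇔adjacent x)))
                        [ inj₁ , [ inj₂ ∘ to (S⇔adjacent x) , (λ ()) ] ]
    vert (inj₂ _) = mk⇔ (λ _ → inj₂ (inj₂ tt)) (λ _ → some-adjacent)

    edge : ∀ x y → Edge AdjZDGModel x y ⇔ Edge (embed₁ (ZDG L₁) ∪ᴳ (N S +ᴳ NL₂ L₁ L₂ a b)) x y
    edge (inj₁ _) (inj₁ _) = mk⇔ inj₁ λ
      { (inj₁ e) → e ; (inj₂ (inj₁ ())) ; (inj₂ (inj₂ (inj₁ ())))
      ; (inj₂ (inj₂ (inj₂ (inj₁ (_ , ()))))) ; (inj₂ (inj₂ (inj₂ (inj₂ (() , _))))) }
    edge (inj₁ x) (inj₂ _) = mk⇔ (λ adj → inj₂ (inj₂ (inj₂ (inj₁ (from (S⇔adjacent x) adj , tt))))) λ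
      { (inj₁ ()) ; (inj₂ (inj₁ ())) ; (inj₂ (inj₂ (inj₁ ())))
      ; (inj₂ (inj₂ (inj₂ (inj₁ (s , _))))) → to (S⇔adjacent x) s
      ; (inj₂ (inj₂ (inj₂ (inj₂ (() , _))))) }
    edge (inj₂ _) (inj₁ y) = mk⇔ (λ adj → inj₂ (inj₂ (inj₂ (inj₂ (tt , from (S⇔adjacent y) adj))))) λ
      { (inj₁ ()) ; (inj₂ (inj₁ ())) ; (inj₂ (inj₂ (inj₁ ())))
      ; (inj₂ (inj₂ (inj₂ (inj₁ (_ , ())))))
      ; (inj₂ (inj₂ (inj₂ (inj₂ (_ , s))))) → to (S⇔adjacent y) s }
    edge (inj₂ y) (inj₂ y′) = mk⇔ (λ ()) λ
      { (inj₁ ()) ; (inj₂ (inj₁ ())) ; (inj₂ (inj₂ (inj₁ ())))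
      ; (inj₂ (inj₂ (inj₂ (inj₁ (s , _))))) → ¬S₂ y s
      ; (inj₂ (inj₂ (inj₂ (inj₂ (_ , s))))) → ¬S₂ y′ s }

  nothing-adjacent : a ≢ ⊥ᴸ → ¬ ZDVert L₁ a → ∀ x → ¬ AdjacentToL₂ x
  nothing-adjacent a≢⊥ a∉V x (x≢⊥ , x∧a≡⊥ , _) = a∉V (a≢⊥ , x , x≢⊥ , ∧≡⊥-comm x∧a≡⊥)

  neighbour⇔adjacent : ZDVert L₁ a → ∀ x → Edge (ZDG L₁) a x ⇔ AdjacentToL₂ x
  neighbour⇔adjacent (a≢⊥ , _) x = mk⇔
    (λ (_ , (x≢⊥ , _) , _ , a∧x≡⊥) →
      x≢⊥ , ∧≡⊥-comm a∧x≡⊥ , λ b≤x → a≢⊥ (≤∧≡⊥⇒≡⊥ (≤-trans (proj₁ a<b) b≤x) a∧x≡⊥))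
    (λ (x≢⊥ , x∧a≡⊥ , _) → zdEdge a≢⊥ x≢⊥ (∧≡⊥-comm x∧a≡⊥))

  neighbour-adjacent : ZDVert L₁ a → ∃ AdjacentToL₂
  neighbour-adjacent a∈V@(a≢⊥ , w , w≢⊥ , a∧w≡⊥) =
    w , to (neighbour⇔adjacent a∈V w) (zdEdge a≢⊥ w≢⊥ a∧w≡⊥)

  module _ (a≡⊥ : a ≡ ⊥ᴸ) where
    outside-↑b⇔adjacent : ∀ x → (x ≢ ⊥ᴸ × ¬ (b ≤ x)) ⇔ AdjacentToL₂ x
    outside-↑b⇔adjacent x = mk⇔
      (λ (x≢⊥ , b≰x) → x≢⊥ , ≤⊥⇒≡⊥ (subst ((x ∧ a) ≤_) a≡⊥ (x∧y≤y x a)) , b≰x)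
      (λ (x≢⊥ , _ , b≰x) → x≢⊥ , b≰x)

    between-adjacent : ¬ (a ⋖ b) → ∃ AdjacentToL₂
    between-adjacent a⋪b with ¬⋖⇒∃-between a<b a⋪b
    ... | z , (_ , a≢z) , (z≤b , z≢b) = z , to (outside-↑b⇔adjacent z)
      ((λ z≡⊥ → a≢z (trans a≡⊥ (sym z≡⊥))) , λ b≤z → z≢b (antisym z≤b b≤z))

theorem2p3 : (L₁ L₂ : FiniteLattice) (a b : FiniteLattice.Carrier L₁) →
    FiniteLattice._<_ L₁ a b → ¬ (FiniteLattice._⋖_ L₁ a b) →
    ((¬ (a ≡ FiniteLattice.⊥ᴸ L₁) → ¬ ZDVert L₁ a →
        AdjZDG L₁ L₂ a b ≅ᴳ embed₁ (ZDG L₁))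
    × (ZDVert L₁ a →
        AdjZDG L₁ L₂ a b ≅ᴳ (embed₁ (ZDG L₁) ∪ᴳ (Gₐ L₁ L₂ a b +ᴳ NL₂ L₁ L₂ a b)))
    × (a ≡ FiniteLattice.⊥ᴸ L₁ →
        AdjZDG L₁ L₂ a b ≅ᴳ (embed₁ (ZDG L₁) ∪ᴳ (NL₁*∖↑b L₁ L₂ a b +ᴳ NL₂ L₁ L₂ a b))))
theorem2p3 L₁ L₂ a b a<b a⋪b =
  (λ a≢⊥ a∉V → ≅ᴳ-trans AdjZDG≅model (model≅ZDG (nothing-adjacent a≢⊥ a∉V))) ,
  (λ a∈V → ≅ᴳ-trans AdjZDG≅model
     (model≅ZDG∪join _ (neighbour⇔adjacent a∈V) (λ _ ()) (neighbour-adjacent a∈V))) ,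
  (λ a≡⊥ → ≅ᴳ-trans AdjZDG≅model
     (model≅ZDG∪join _ (outside-↑b⇔adjacent a≡⊥) (λ _ ()) (between-adjacent a≡⊥ a⋪b)))
  where open Adjunct L₁ L₂ a b a<b
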